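{- For any $n\ge1$ and sequences $X=(x_1,\dots,x_{n-1})$, $Y=(y_1,\dots,y_{n-1})$ of commuting scalars, $$(K_n(X),K_n(Y))=\prod_{i=1}^{n-1}(y_i-x_i).$$
   Context: Identify $\mathbf{Sym}_n$ (noncommutative symmetric functions of degree $n$) with the Grassmann algebra on anticommuting generators $\eta_1,\dots,\eta_{n-1}$ via $R_I\leftrightarrow\eta_{d_1}\cdots\eta_{d_k}$, $R_I$ the ribbon basis, $\mathrm{Des}(I)=\{d_1<\dots<d_k\}$. Scalars commute with the $\eta_i$. $K_n(Z)=(1+z_1\eta_1)(1+z_2\eta_2)\cdots(1+z_{n-1}\eta_{n-1})$. Let $*$ be the anti-involution (reversing products) with $\eta_i^*=(-1)^i\eta_i$, fixing scalars. The Grassmann integral $\int d\eta\, f$ is the coefficient of $\eta_1\eta_2\cdots\eta_{n-1}$ in $f$ (written with increasing indices). The bilinear form is $(f,g)=\int d\eta\, f^*g$. -}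

module Defs where

open import Level using (_⊔_)
open import Algebra.Bundles using (CommutativeRing)
open import Data.Bool using (Bool; true; false; if_then_else_; not)
open import Data.Nat using (ℕ; zero; suc)
open import Data.Fin using (Fin; toℕ)
open import Data.List using (List; []; _∷_; foldr; map; filter; reverse; allFin; _++_)
open import Data.Vec using (Vec; []; _∷_; lookup; replicate)
open import Data.Vec.Properties using (≡-dec)
import Data.Bool.Properties as BoolP
open import Data.Maybe using (Maybe; just; nothing)
open import Data.Product using (_×_; _,_)
open import Relation.Nullary using (yes; no)
open import Relation.Nullary.Decidable using (does)

-- Grassmann algebra on m = n-1 anticommuting generators η_1 … η_m over a
-- commutative ring R of scalars.  An element is given by its coefficient
-- function on the monomial basis η_S = η_{d1}⋯η_{dk} (d1 < ⋯ < dk), where the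
-- subset S ⊆ {1,…,m} is encoded as a Vec Bool m (position i ↔ η_{i+1}).
module Grassmann {c ℓ} (R : CommutativeRing c ℓ) where
  open CommutativeRing R hiding (zero)

  Subset : ℕ → Set
  Subset m = Vec Bool m

  allSubsets : (m : ℕ) → List (Subset m)
  allSubsets zero    = [] ∷ []
  allSubsets (suc m) = map (false ∷_) (allSubsets m) ++ map (true ∷_) (allSubsets m)

  Σ-list : ∀ {a} {A : Set a} → List A → (A → Carrier) → Carrier
  Σ-list xs f = foldr (λ x acc → f x + acc) 0# xs

  ∏-list : ∀ {a} {A : Set a} → List A → (A → Carrier) → Carrier
  ∏-list xs f = foldr (λ x acc → f x * acc) 1# xs

  card : ∀ {m} → Subset m → ℕ
  card []          = zero
  card (false ∷ s) = card s
  card (true  ∷ s) = suc (card s)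

  odd : ℕ → Bool
  odd zero    = false
  odd (suc k) = not (odd k)

  -- product of basis monomials: η_S η_T = nothing (zero) if S ∩ T ≠ ∅,
  -- otherwise just (neg , S ∪ T) meaning η_S η_T = (-1)^neg η_{S∪T},
  -- neg = parity of #{(s,t) ∈ S×T | s > t}.
  mulBasis : ∀ {m} → Subset m → Subset m → Maybe (Bool × Subset m)
  mulBasis [] [] = just (false , [])
  mulBasis (a ∷ s) (b ∷ t) with mulBasis s t
  ... | nothing = nothing
  ... | just (ν , u) with a | b
  ...   | true  | true  = nothing
  ...   | true  | false = just (ν , true ∷ u)
  ...   | false | true  = just ((if odd (card s) then not ν else ν) , true ∷ u)
  ...   | false | false = just (ν , false ∷ u)

  G : ℕ → Set c
  G m = Subset m → Carrier

  _≟S_ : ∀ {m} (s t : Subset m) → _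
  s ≟S t = ≡-dec BoolP._≟_ s t

  mulCoeff : ∀ {m} → Subset m → Subset m → Subset m → Carrier
  mulCoeff s t u with mulBasis s t
  ... | nothing = 0#
  ... | just (ν , v) = if does (v ≟S u) then (if ν then - 1# else 1#) else 0#

  infixl 7 _·_
  infixl 6 _⊕_
  _·_ : ∀ {m} → G m → G m → G m
  (f · g) u = Σ-list (allSubsets _) λ s → Σ-list (allSubsets _) λ t →
                f s * g t * mulCoeff s t u

  _⊕_ : ∀ {m} → G m → G m → G m
  (f ⊕ g) u = f u + g u

  scal : ∀ {m} → Carrier → G m → G m
  scal r f u = r * f u

  basis : ∀ {m} → Subset m → G m
  basis s u = if does (s ≟S u) then 1# else 0#

  one : ∀ {m} → G m
  one = basis (replicate _ false)

  -- generator η_{i+1} for i : Fin m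
  single : ∀ {m} → Fin m → Subset m
  single {suc m} Fin.zero    = true ∷ replicate m false
  single {suc m} (Fin.suc i) = false ∷ single i

  η : ∀ {m} → Fin m → G m
  η i = basis (single i)

  -- K_n(Z) = (1 + z_1 η_1)(1 + z_2 η_2)⋯(1 + z_{n-1} η_{n-1}),  m = n-1
  K : ∀ {m} → (Fin m → Carrier) → G m
  K {m} z = foldr (λ i acc → (one ⊕ scal (z i) (η i)) · acc) one (allFin m)

  indices : ∀ {m} → Subset m → List (Fin m)
  indices {m} s = filter (λ i → BoolP.T? (lookup s i)) (allFin m)

  -- η_i^* = (-1)^i η_i   (generator η_i has index i = toℕ j + 1)
  ηstar : ∀ {m} → Fin m → G m
  ηstar j = if odd (suc (toℕ j)) then scal (- 1#) (η j) else η j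

  starBasis : ∀ {m} → Subset m → G m
  starBasis s = foldr (λ i acc → acc · ηstar i) one (indices s)

  star : ∀ {m} → G m → G m
  star f u = Σ-list (allSubsets _) λ s → f s * starBasis s u

  ∫ : ∀ {m} → G m → Carrier
  ∫ f = f (replicate _ true)

  form : ∀ {m} → G m → G m → Carrier
  form f g = ∫ (star f · g)

-- Split every element of the Grassmann algebra on η₁,…,η_m along the first
-- generator, f = f₀ + η₁ f₁ with f₀, f₁ in the algebra on η₂,…,η_m.
-- Then (f g)₀ = f₀ g₀ and (f g)₁ = f̂₀ g₁ + f₁ g₀, where ^ is the grade
-- involution, while K(Z)₀ = K(Z') and K(Z)₁ = z₁ K(Z') for Z' = (z₂,…,z_m).
-- Shifting indices by one changes the sign rule of the star, so one works
-- with the family (f, g)ᵖ = ∫ (^ᵖ ∘ *ᵖ)(f) g, where *ᵖ is the anti-involution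
-- with η_i ↦ (-1)^(i+p) η_i; the form of the theorem is the case p = 0.
-- Extracting the coefficient of η₁ gives (f, g)ᵖ = (f₀, g₁)ᵖ⁺¹ - (f₁, g₀)ᵖ⁺¹,
-- so (K(X), K(Y))ᵖ = (y₁ - x₁)(K(X'), K(Y'))ᵖ⁺¹, and the theorem follows by
-- induction on m.
module Submission where

open import Defs
open import Algebra.Bundles using (CommutativeRing)
open import Data.Nat using (ℕ; zero; suc; _≤_; _∸_)
open import Data.Fin using (Fin; toℕ)
open import Data.List using (List; []; _∷_; _++_; foldr; map; filter; allFin)
open import Data.List.Properties using (foldr-map; map-tabulate)
open import Data.Vec using ([]; _∷_; lookup)
open import Data.Vec.Functional using (tail)
open import Data.Bool using (Bool; true; false; not; if_then_else_; _xor_; T?)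
open import Data.Maybe using (just; nothing)
open import Data.Product using (_,_)
open import Relation.Nullary.Decidable using (does)
open import Relation.Binary.PropositionalEquality as ≡ using (_≡_)
import Relation.Binary.Reasoning.Setoid as SetoidReasoning

allFin-suc : ∀ m → allFin (suc m) ≡ Fin.zero ∷ map Fin.suc (allFin m)
allFin-suc m = ≡.cong (Fin.zero ∷_) (≡.sym (map-tabulate (λ i → i) Fin.suc))

module _ {c ℓ} (R : CommutativeRing c ℓ) where
  open CommutativeRing R hiding (zero)
  open Grassmann R
  open SetoidReasoning setoid
  open import Algebra.Properties.Ring ring
    using (-1*x≈-x; -‿distribˡ-*; -‿distribʳ-*; -‿involutive; -0#≈0#)
  open import Algebra.Properties.CommutativeSemigroup +-commutativeSemigroup
    using (interchange)
  open import Algebra.Properties.CommutativeSemigroup *-commutativeSemigroup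
    using (x∙yz≈y∙xz; x∙yz≈yx∙z)

  module _ {a} {A : Set a} where

    Σ-cong : (xs : List A) {f g : A → Carrier} → (∀ x → f x ≈ g x) → Σ-list xs f ≈ Σ-list xs g
    Σ-cong []       f≈g = refl
    Σ-cong (x ∷ xs) f≈g = +-cong (f≈g x) (Σ-cong xs f≈g)

    Σ-zero : (xs : List A) {f : A → Carrier} → (∀ x → f x ≈ 0#) → Σ-list xs f ≈ 0#
    Σ-zero []       f≈0 = refl
    Σ-zero (x ∷ xs) f≈0 = trans (+-cong (f≈0 x) (Σ-zero xs f≈0)) (+-identityˡ 0#)

    Σ-++ : (xs ys : List A) (f : A → Carrier) → Σ-list (xs ++ ys) f ≈ Σ-list xs f + Σ-list ys f
    Σ-++ []       ys f = sym (+-identityˡ _)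
    Σ-++ (x ∷ xs) ys f = trans (+-congˡ (Σ-++ xs ys f)) (sym (+-assoc _ _ _))

    Σ-+ : (xs : List A) (f g : A → Carrier) →
          Σ-list xs (λ x → f x + g x) ≈ Σ-list xs f + Σ-list xs g
    Σ-+ []       f g = sym (+-identityˡ 0#)
    Σ-+ (x ∷ xs) f g = trans (+-congˡ (Σ-+ xs f g)) (interchange _ _ _ _)

    Σ-*ˡ : (xs : List A) (r : Carrier) (f : A → Carrier) →
           Σ-list xs (λ x → r * f x) ≈ r * Σ-list xs f
    Σ-*ˡ []       r f = sym (zeroʳ r)
    Σ-*ˡ (x ∷ xs) r f = trans (+-congˡ (Σ-*ˡ xs r f)) (sym (distribˡ r _ _))

    Σ-neg : (xs : List A) (f : A → Carrier) → Σ-list xs (λ x → - f x) ≈ - Σ-list xs f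
    Σ-neg xs f = begin
      Σ-list xs (λ x → - f x)        ≈⟨ Σ-cong xs (λ x → sym (-1*x≈-x (f x))) ⟩
      Σ-list xs (λ x → - 1# * f x)   ≈⟨ Σ-*ˡ xs (- 1#) f ⟩
      - 1# * Σ-list xs f             ≈⟨ -1*x≈-x _ ⟩
      - Σ-list xs f                  ∎

    Σ-map : ∀ {b} {B : Set b} (h : B → A) (xs : List B) (f : A → Carrier) →
            Σ-list (map h xs) f ≡ Σ-list xs (λ x → f (h x))
    Σ-map h xs f = foldr-map _ h 0# xs

    ∏-map : ∀ {b} {B : Set b} (h : B → A) (xs : List B) (f : A → Carrier) →
            ∏-list (map h xs) f ≡ ∏-list xs (λ x → f (h x))
    ∏-map h xs f = foldr-map _ h 1# xs

  ∏-allFin-suc : ∀ {m} (f : Fin (suc m) → Carrier) →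
                 ∏-list (allFin (suc m)) f ≈ f Fin.zero * ∏-list (allFin m) (λ i → f (Fin.suc i))
  ∏-allFin-suc {m} f = reflexive (≡.trans (≡.cong (λ xs → ∏-list xs f) (allFin-suc m))
                                          (≡.cong (f Fin.zero *_) (∏-map Fin.suc (allFin m) f)))

  Σ-allSubsets-suc : ∀ m (f : Subset (suc m) → Carrier) →
    Σ-list (allSubsets (suc m)) f ≈
    Σ-list (allSubsets m) (λ s → f (false ∷ s)) + Σ-list (allSubsets m) (λ s → f (true ∷ s))
  Σ-allSubsets-suc m f = trans (Σ-++ (map (false ∷_) (allSubsets m)) _ f)
    (+-cong (reflexive (Σ-map (false ∷_) (allSubsets m) f))
            (reflexive (Σ-map (true ∷_) (allSubsets m) f)))

  Σ² : ∀ {m} → (Subset m → Subset m → Carrier) → Carrier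
  Σ² {m} F = Σ-list (allSubsets m) λ s → Σ-list (allSubsets m) λ t → F s t

  Σ²-cong : ∀ {m} {F F′ : Subset m → Subset m → Carrier} →
            (∀ s t → F s t ≈ F′ s t) → Σ² F ≈ Σ² F′
  Σ²-cong {m} F≈F′ = Σ-cong (allSubsets m) λ s → Σ-cong (allSubsets m) λ t → F≈F′ s t

  Σ²-zero : ∀ {m} {F : Subset m → Subset m → Carrier} → (∀ s t → F s t ≈ 0#) → Σ² F ≈ 0#
  Σ²-zero {m} F≈0 = Σ-zero (allSubsets m) λ s → Σ-zero (allSubsets m) λ t → F≈0 s t

  sgn : Bool → Carrier
  sgn b = if b then - 1# else 1#

  sgn-not : ∀ p → sgn p * sgn (not p) ≈ - 1#
  sgn-not false = *-identityˡ _
  sgn-not true  = *-identityʳ _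

  -- In mulCoeff-ab-c the digits say whether η₁ occurs in the three monomials.
  mulCoeff-00-0 : ∀ {m} (s t u : Subset m) → mulCoeff (false ∷ s) (false ∷ t) (false ∷ u) ≈ mulCoeff s t u
  mulCoeff-00-0 s t u with mulBasis s t
  ... | nothing      = refl
  ... | just (_ , _) = refl

  mulCoeff-00-1 : ∀ {m} (s t u : Subset m) → mulCoeff (false ∷ s) (false ∷ t) (true ∷ u) ≈ 0#
  mulCoeff-00-1 s t u with mulBasis s t
  ... | nothing      = refl
  ... | just (_ , _) = refl

  mulCoeff-01-0 : ∀ {m} (s t u : Subset m) → mulCoeff (false ∷ s) (true ∷ t) (false ∷ u) ≈ 0#
  mulCoeff-01-0 s t u with mulBasis s t
  ... | nothing      = refl
  ... | just (_ , _) = refl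

  -- η_s η₁ = (-1)^|s| η₁ η_s.
  mulCoeff-01-1 : ∀ {m} (s t u : Subset m) →
                  mulCoeff (false ∷ s) (true ∷ t) (true ∷ u) ≈ sgn (odd (card s)) * mulCoeff s t u
  mulCoeff-01-1 s t u with mulBasis s t
  ... | nothing = sym (zeroʳ _)
  ... | just (ν , v) with does (v ≟S u) | odd (card s) | ν
  ... | false | _     | _     = sym (zeroʳ _)
  ... | true  | false | _     = sym (*-identityˡ _)
  ... | true  | true  | false = sym (-1*x≈-x 1#)
  ... | true  | true  | true  = sym (trans (-1*x≈-x _) (-‿involutive 1#))

  mulCoeff-10-0 : ∀ {m} (s t u : Subset m) → mulCoeff (true ∷ s) (false ∷ t) (false ∷ u) ≈ 0#
  mulCoeff-10-0 s t u with mulBasis s t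
  ... | nothing      = refl
  ... | just (_ , _) = refl

  mulCoeff-10-1 : ∀ {m} (s t u : Subset m) → mulCoeff (true ∷ s) (false ∷ t) (true ∷ u) ≈ mulCoeff s t u
  mulCoeff-10-1 s t u with mulBasis s t
  ... | nothing      = refl
  ... | just (_ , _) = refl

  mulCoeff-11 : ∀ {m} (s t u : Subset m) b → mulCoeff (true ∷ s) (true ∷ t) (b ∷ u) ≈ 0#
  mulCoeff-11 s t u b with mulBasis s t
  ... | nothing      = refl
  ... | just (_ , _) = refl

  infix 4 _≋_
  _≋_ : ∀ {m} → G m → G m → Set ℓ
  f ≋ g = ∀ u → f u ≈ g u

  0G : ∀ {m} → G m
  0G _ = 0#

  infix 9 _₀ _₁
  _₀ _₁ : ∀ {m} → G (suc m) → G m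
  (f ₀) u = f (false ∷ u)
  (f ₁) u = f (true ∷ u)

  grade : ∀ {m} → G m → G m
  grade f u = if odd (card u) then - f u else f u

  grade-cong : ∀ {m} {f g : G m} → f ≋ g → grade f ≋ grade g
  grade-cong f≋g u with odd (card u)
  ... | false = f≋g u
  ... | true  = -‿cong (f≋g u)

  grade-scal : ∀ {m} r (f : G m) → grade (scal r f) ≋ scal r (grade f)
  grade-scal r f u with odd (card u)
  ... | false = refl
  ... | true  = -‿distribʳ-* _ _

  grade-involutive : ∀ {m} (f : G m) → grade (grade f) ≋ f
  grade-involutive f u with odd (card u)
  ... | false = refl
  ... | true  = -‿involutive _

  grade-one : ∀ {m} → grade (one {m}) ≋ one
  grade-one []          = refl
  grade-one (false ∷ u) = grade-one u
  grade-one (true ∷ u) with odd (card u)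
  ... | false = -0#≈0#
  ... | true  = refl

  grade-Σ : ∀ {m} (f : Subset m → Carrier) (B : Subset m → G m) r u →
    Σ-list (allSubsets m) (λ s → f s * (r * grade (B s) u)) ≈
    r * grade (λ u′ → Σ-list (allSubsets m) λ s → f s * B s u′) u
  grade-Σ {m} f B r u with odd (card u)
  ... | false = trans (Σ-cong (allSubsets m) (λ s → x∙yz≈y∙xz _ _ _)) (Σ-*ˡ (allSubsets m) r _)
  ... | true  = begin
    Σ-list (allSubsets m) (λ s → f s * (r * - B s u))
      ≈⟨ Σ-cong (allSubsets m) (λ s → trans (x∙yz≈y∙xz _ _ _) (*-congˡ (sym (-‿distribʳ-* _ _)))) ⟩
    Σ-list (allSubsets m) (λ s → r * - (f s * B s u))  ≈⟨ Σ-*ˡ (allSubsets m) r _ ⟩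
    r * Σ-list (allSubsets m) (λ s → - (f s * B s u))  ≈⟨ *-congˡ (Σ-neg (allSubsets m) _) ⟩
    r * - Σ-list (allSubsets m) (λ s → f s * B s u)    ∎

  ·-expand : ∀ {m} (f g : G (suc m)) b u → (f · g) (b ∷ u) ≈
     (Σ² (λ s t → f (false ∷ s) * g (false ∷ t) * mulCoeff (false ∷ s) (false ∷ t) (b ∷ u))
      + Σ² (λ s t → f (false ∷ s) * g (true ∷ t) * mulCoeff (false ∷ s) (true ∷ t) (b ∷ u)))
     + (Σ² (λ s t → f (true ∷ s) * g (false ∷ t) * mulCoeff (true ∷ s) (false ∷ t) (b ∷ u))
      + Σ² (λ s t → f (true ∷ s) * g (true ∷ t) * mulCoeff (true ∷ s) (true ∷ t) (b ∷ u)))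
  ·-expand {m} f g b u = trans (Σ-allSubsets-suc m _) (+-cong
    (trans (Σ-cong (allSubsets m) (λ s → Σ-allSubsets-suc m _)) (Σ-+ (allSubsets m) _ _))
    (trans (Σ-cong (allSubsets m) (λ s → Σ-allSubsets-suc m _)) (Σ-+ (allSubsets m) _ _)))

  ·₀ : ∀ {m} (f g : G (suc m)) → (f · g) ₀ ≋ f ₀ · g ₀
  ·₀ f g u = begin
    (f · g) (false ∷ u)  ≈⟨ ·-expand f g false u ⟩
    _                    ≈⟨ +-cong
      (+-cong (Σ²-cong (λ s t → *-congˡ (mulCoeff-00-0 s t u)))
              (Σ²-zero (λ s t → trans (*-congˡ (mulCoeff-01-0 s t u)) (zeroʳ _))))
      (+-cong (Σ²-zero (λ s t → trans (*-congˡ (mulCoeff-10-0 s t u)) (zeroʳ _)))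
              (Σ²-zero (λ s t → trans (*-congˡ (mulCoeff-11 s t u false)) (zeroʳ _)))) ⟩
    ((f ₀ · g ₀) u + 0#) + (0# + 0#)
                         ≈⟨ trans (+-congˡ (+-identityˡ 0#)) (trans (+-identityʳ _) (+-identityʳ _)) ⟩
    (f ₀ · g ₀) u        ∎

  ·₁ : ∀ {m} (f g : G (suc m)) → (f · g) ₁ ≋ grade (f ₀) · g ₁ ⊕ f ₁ · g ₀
  ·₁ f g u = begin
    (f · g) (true ∷ u)  ≈⟨ ·-expand f g true u ⟩
    _                   ≈⟨ +-cong
      (+-cong (Σ²-zero (λ s t → trans (*-congˡ (mulCoeff-00-1 s t u)) (zeroʳ _)))
              (Σ²-cong (λ s t → trans (*-congˡ (mulCoeff-01-1 s t u)) (sign-into-grade (f ₀) s _ _))))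
      (+-cong (Σ²-cong (λ s t → *-congˡ (mulCoeff-10-1 s t u)))
              (Σ²-zero (λ s t → trans (*-congˡ (mulCoeff-11 s t u true)) (zeroʳ _)))) ⟩
    (0# + (grade (f ₀) · g ₁) u) + ((f ₁ · g ₀) u + 0#)
                        ≈⟨ +-cong (+-identityˡ _) (+-identityʳ _) ⟩
    (grade (f ₀) · g ₁) u + (f ₁ · g ₀) u ∎
    where
    sign-into-grade : ∀ {m} (h : G m) s y z → h s * y * (sgn (odd (card s)) * z) ≈ grade h s * y * z
    sign-into-grade h s y z with odd (card s)
    ... | false = *-congˡ (*-identityˡ z)
    ... | true  = begin
      h s * y * (- 1# * z)  ≈⟨ *-congˡ (-1*x≈-x z) ⟩
      h s * y * - z         ≈⟨ -‿distribʳ-* _ _ ⟨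
      - (h s * y * z)       ≈⟨ -‿distribˡ-* _ _ ⟩
      - (h s * y) * z       ≈⟨ *-congʳ (-‿distribˡ-* _ _) ⟩
      - h s * y * z         ∎

  ·-cong : ∀ {m} {f f′ g g′ : G m} → f ≋ f′ → g ≋ g′ → f · g ≋ f′ · g′
  ·-cong {m} f≋f′ g≋g′ u = Σ²-cong {m} (λ s t → *-congʳ (*-cong (f≋f′ s) (g≋g′ t)))

  ·-zeroˡ : ∀ {m} (g : G m) → 0G · g ≋ 0G
  ·-zeroˡ {m} g u = Σ²-zero {m} (λ s t → trans (*-congʳ (zeroˡ _)) (zeroˡ _))

  ·-zeroʳ : ∀ {m} (f : G m) → f · 0G ≋ 0G
  ·-zeroʳ {m} f u = Σ²-zero {m} (λ s t → trans (*-congʳ (zeroʳ _)) (zeroˡ _))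

  ·-scalˡ : ∀ {m} r (f g : G m) → scal r f · g ≋ scal r (f · g)
  ·-scalˡ {m} r f g u = begin
    Σ² (λ s t → r * f s * g t * mulCoeff s t u)
      ≈⟨ Σ²-cong {m} (λ s t → trans (*-congʳ (*-assoc _ _ _)) (*-assoc _ _ _)) ⟩
    Σ² (λ s t → r * (f s * g t * mulCoeff s t u))
      ≈⟨ Σ-cong (allSubsets m) (λ s → Σ-*ˡ (allSubsets m) r _) ⟩
    Σ-list (allSubsets m) (λ s → r * Σ-list (allSubsets m) (λ t → f s * g t * mulCoeff s t u))
                                                   ≈⟨ Σ-*ˡ (allSubsets m) r _ ⟩
    r * (f · g) u                                  ∎

  ·-scalʳ : ∀ {m} r (f g : G m) → f · scal r g ≋ scal r (f · g)
  ·-scalʳ {m} r f g u =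
    trans (Σ²-cong {m} (λ s t → *-congʳ (x∙yz≈yx∙z (f s) r (g t)))) (·-scalˡ r f g u)

  shift : ∀ {m} → G m → G (suc m)
  shift f (false ∷ u) = f u
  shift f (true ∷ u)  = 0#

  shift-· : ∀ {m} (f g : G m) → shift f · shift g ≋ shift (f · g)
  shift-· f g (false ∷ u) = ·₀ (shift f) (shift g) u
  shift-· f g (true ∷ u)  = begin
    (shift f · shift g) (true ∷ u)         ≈⟨ ·₁ (shift f) (shift g) u ⟩
    (grade f · 0G) u + (0G · g) u          ≈⟨ +-cong (·-zeroʳ (grade f) u) (·-zeroˡ g u) ⟩
    0# + 0#                                ≈⟨ +-identityˡ 0# ⟩
    0#                                     ∎

  one≋shift-one : ∀ {m} → one {suc m} ≋ shift one
  one≋shift-one (false ∷ u) = refl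
  one≋shift-one (true ∷ u)  = refl

  ·-identityˡ : ∀ {m} (g : G m) → one · g ≋ g
  ·-identityˡ {zero} g [] =
    trans (+-identityʳ _) (trans (+-identityʳ _) (trans (*-identityʳ _) (*-identityˡ _)))
  ·-identityˡ {suc m} g (false ∷ u) = trans (·₀ one g u) (·-identityˡ (g ₀) u)
  ·-identityˡ {suc m} g (true ∷ u)  = begin
    (one · g) (true ∷ u)                   ≈⟨ ·₁ one g u ⟩
    (grade one · g ₁) u + (0G · g ₀) u
      ≈⟨ +-cong (·-cong grade-one (λ _ → refl) u) (·-zeroˡ (g ₀) u) ⟩
    (one · g ₁) u + 0#                     ≈⟨ +-identityʳ _ ⟩
    (one · g ₁) u                          ≈⟨ ·-identityˡ (g ₁) u ⟩
    g (true ∷ u)                           ∎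

  ·-identityʳ : ∀ {m} (f : G m) → f · one ≋ f
  ·-identityʳ {zero} f [] =
    trans (+-identityʳ _) (trans (+-identityʳ _) (trans (*-identityʳ _) (*-identityʳ _)))
  ·-identityʳ {suc m} f (false ∷ u) = trans (·₀ f one u) (·-identityʳ (f ₀) u)
  ·-identityʳ {suc m} f (true ∷ u)  = begin
    (f · one) (true ∷ u)                   ≈⟨ ·₁ f one u ⟩
    (grade (f ₀) · 0G) u + (f ₁ · one) u
      ≈⟨ +-cong (·-zeroʳ (grade (f ₀)) u) (·-identityʳ (f ₁) u) ⟩
    0# + f (true ∷ u)                      ≈⟨ +-identityˡ _ ⟩
    f (true ∷ u)                           ∎

  factor : ∀ {m} → (Fin m → Carrier) → Fin m → G m
  factor z i = one ⊕ scal (z i) (η i)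

  K-from : ∀ {m} → (Fin m → Carrier) → List (Fin m) → G m
  K-from z is = foldr (λ i acc → factor z i · acc) one is

  factor-suc : ∀ {m} (z : Fin (suc m) → Carrier) i → factor z (Fin.suc i) ≋ shift (factor (tail z) i)
  factor-suc z i (false ∷ u) = refl
  factor-suc z i (true ∷ u)  = trans (+-identityˡ _) (zeroʳ _)

  K-from-map-suc : ∀ {m} (z : Fin (suc m) → Carrier) is →
                   K-from z (map Fin.suc is) ≋ shift (K-from (tail z) is)
  K-from-map-suc z []       = one≋shift-one
  K-from-map-suc z (i ∷ is) u =
    trans (·-cong (factor-suc z i) (K-from-map-suc z is) u) (shift-· _ _ u)

  K-suc : ∀ {m} (z : Fin (suc m) → Carrier) → K z ≋ factor z Fin.zero · shift (K (tail z))
  K-suc {m} z u = trans (reflexive (≡.cong (λ is → K-from z is u) (allFin-suc m)))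
                        (·-cong (λ _ → refl) (K-from-map-suc z (allFin m)) u)

  K₀ : ∀ {m} (z : Fin (suc m) → Carrier) → K z ₀ ≋ K (tail z)
  K₀ z u = begin
    K z (false ∷ u)                                       ≈⟨ K-suc z (false ∷ u) ⟩
    (factor z Fin.zero · shift (K (tail z))) (false ∷ u)  ≈⟨ ·₀ (factor z Fin.zero) _ u ⟩
    (factor z Fin.zero ₀ · K (tail z)) u
      ≈⟨ ·-cong (λ s → trans (+-congˡ (zeroʳ _)) (+-identityʳ _)) (λ _ → refl) u ⟩
    (one · K (tail z)) u                                  ≈⟨ ·-identityˡ _ u ⟩
    K (tail z) u                                          ∎

  K₁ : ∀ {m} (z : Fin (suc m) → Carrier) → K z ₁ ≋ scal (z Fin.zero) (K (tail z))
  K₁ z u = begin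
    K z (true ∷ u)                                        ≈⟨ K-suc z (true ∷ u) ⟩
    (factor z Fin.zero · shift (K (tail z))) (true ∷ u)   ≈⟨ ·₁ (factor z Fin.zero) _ u ⟩
    (grade (factor z Fin.zero ₀) · 0G) u + (factor z Fin.zero ₁ · K (tail z)) u
      ≈⟨ +-cong (·-zeroʳ _ u) (·-cong (λ s → +-identityˡ _) (λ _ → refl) u) ⟩
    0# + (scal (z Fin.zero) one · K (tail z)) u           ≈⟨ +-identityˡ _ ⟩
    (scal (z Fin.zero) one · K (tail z)) u                ≈⟨ ·-scalˡ (z Fin.zero) one _ u ⟩
    z Fin.zero * (one · K (tail z)) u                     ≈⟨ *-congˡ (·-identityˡ _ u) ⟩
    z Fin.zero * K (tail z) u                             ∎

  -- The star with η_i ↦ (-1)^(i+p) η_i; for p = false these are ηstar,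
  -- starBasis and star definitionally.
  ηstarᵖ : ∀ {m} → Bool → Fin m → G m
  ηstarᵖ p j = if p xor odd (suc (toℕ j)) then scal (- 1#) (η j) else η j

  starBasisᵖ-from : ∀ {m} → Bool → List (Fin m) → G m
  starBasisᵖ-from p is = foldr (λ i acc → acc · ηstarᵖ p i) one is

  starBasisᵖ : ∀ {m} → Bool → Subset m → G m
  starBasisᵖ p s = starBasisᵖ-from p (indices s)

  starᵖ : ∀ {m} → Bool → G m → G m
  starᵖ {m} p f u = Σ-list (allSubsets m) λ s → f s * starBasisᵖ p s u

  filter-map-suc : ∀ {m} b (s : Subset m) (is : List (Fin m)) →
    filter (λ i → T? (lookup (b ∷ s) i)) (map Fin.suc is) ≡
    map Fin.suc (filter (λ i → T? (lookup s i)) is)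
  filter-map-suc b s []       = ≡.refl
  filter-map-suc b s (i ∷ is) with lookup s i
  ... | false = filter-map-suc b s is
  ... | true  = ≡.cong (Fin.suc i ∷_) (filter-map-suc b s is)

  indices-false : ∀ {m} (s : Subset m) → indices (false ∷ s) ≡ map Fin.suc (indices s)
  indices-false {m} s = ≡.trans (≡.cong (filter (λ i → T? (lookup (false ∷ s) i))) (allFin-suc m))
                                (filter-map-suc false s (allFin m))

  indices-true : ∀ {m} (s : Subset m) → indices (true ∷ s) ≡ Fin.zero ∷ map Fin.suc (indices s)
  indices-true {m} s = ≡.trans (≡.cong (filter (λ i → T? (lookup (true ∷ s) i))) (allFin-suc m))
                               (≡.cong (Fin.zero ∷_) (filter-map-suc true s (allFin m)))

  ηstarᵖ-suc : ∀ {m} p (i : Fin m) → ηstarᵖ p (Fin.suc i) ≋ shift (ηstarᵖ (not p) i)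
  ηstarᵖ-suc p i (true ∷ u) with p xor odd (suc (suc (toℕ i)))
  ... | false = refl
  ... | true  = zeroʳ _
  ηstarᵖ-suc p i (false ∷ u) with odd (toℕ i) | p
  ... | false | false = refl
  ... | false | true  = refl
  ... | true  | false = refl
  ... | true  | true  = refl

  ηstarᵖ-zero₀ : ∀ {m} p → ηstarᵖ {suc m} p Fin.zero ₀ ≋ 0G
  ηstarᵖ-zero₀ false u = zeroʳ _
  ηstarᵖ-zero₀ true  u = refl

  ηstarᵖ-zero₁ : ∀ {m} p → ηstarᵖ {suc m} p Fin.zero ₁ ≋ scal (sgn (not p)) one
  ηstarᵖ-zero₁ false u = refl
  ηstarᵖ-zero₁ true  u = sym (*-identityˡ _)

  starBasisᵖ-from-map-suc : ∀ {m} p (is : List (Fin m)) →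
                            starBasisᵖ-from p (map Fin.suc is) ≋ shift (starBasisᵖ-from (not p) is)
  starBasisᵖ-from-map-suc p []       = one≋shift-one
  starBasisᵖ-from-map-suc p (i ∷ is) u =
    trans (·-cong (starBasisᵖ-from-map-suc p is) (ηstarᵖ-suc p i) u) (shift-· _ _ u)

  starBasisᵖ-false : ∀ {m} p (s : Subset m) → starBasisᵖ p (false ∷ s) ≋ shift (starBasisᵖ (not p) s)
  starBasisᵖ-false p s u = trans (reflexive (≡.cong (λ is → starBasisᵖ-from p is u) (indices-false s)))
                                 (starBasisᵖ-from-map-suc p (indices s) u)

  starBasisᵖ-true : ∀ {m} p (s : Subset m) →
                    starBasisᵖ p (true ∷ s) ≋ shift (starBasisᵖ (not p) s) · ηstarᵖ p Fin.zero
  starBasisᵖ-true p s u = trans (reflexive (≡.cong (λ is → starBasisᵖ-from p is u) (indices-true s)))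
                                (·-cong (starBasisᵖ-from-map-suc p (indices s)) (λ _ → refl) u)

  starBasisᵖ-true₀ : ∀ {m} p (s : Subset m) → starBasisᵖ p (true ∷ s) ₀ ≋ 0G
  starBasisᵖ-true₀ p s u = begin
    starBasisᵖ p (true ∷ s) (false ∷ u)          ≈⟨ starBasisᵖ-true p s (false ∷ u) ⟩
    (shift B · ηstarᵖ p Fin.zero) (false ∷ u)    ≈⟨ ·₀ _ _ u ⟩
    (B · ηstarᵖ p Fin.zero ₀) u                  ≈⟨ ·-cong (λ _ → refl) (ηstarᵖ-zero₀ p) u ⟩
    (B · 0G) u                                   ≈⟨ ·-zeroʳ B u ⟩
    0#                                           ∎
    where B = starBasisᵖ (not p) s

  starBasisᵖ-true₁ : ∀ {m} p (s : Subset m) →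
                     starBasisᵖ p (true ∷ s) ₁ ≋ scal (sgn (not p)) (grade (starBasisᵖ (not p) s))
  starBasisᵖ-true₁ p s u = begin
    starBasisᵖ p (true ∷ s) (true ∷ u)           ≈⟨ starBasisᵖ-true p s (true ∷ u) ⟩
    (shift B · ηstarᵖ p Fin.zero) (true ∷ u)     ≈⟨ ·₁ _ _ u ⟩
    (grade B · ηstarᵖ p Fin.zero ₁) u + (0G · ηstarᵖ p Fin.zero ₀) u
      ≈⟨ +-cong (·-cong (λ _ → refl) (ηstarᵖ-zero₁ p) u) (·-zeroˡ _ u) ⟩
    (grade B · scal (sgn (not p)) one) u + 0#    ≈⟨ +-identityʳ _ ⟩
    (grade B · scal (sgn (not p)) one) u         ≈⟨ ·-scalʳ _ _ _ u ⟩
    sgn (not p) * (grade B · one) u              ≈⟨ *-congˡ (·-identityʳ _ u) ⟩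
    sgn (not p) * grade B u                      ∎
    where B = starBasisᵖ (not p) s

  starᵖ₀ : ∀ {m} p (f : G (suc m)) → starᵖ p f ₀ ≋ starᵖ (not p) (f ₀)
  starᵖ₀ {m} p f u = begin
    starᵖ p f (false ∷ u)                        ≈⟨ Σ-allSubsets-suc m _ ⟩
    Σ-list (allSubsets m) (λ s → f (false ∷ s) * starBasisᵖ p (false ∷ s) (false ∷ u))
      + Σ-list (allSubsets m) (λ s → f (true ∷ s) * starBasisᵖ p (true ∷ s) (false ∷ u))
      ≈⟨ +-cong (Σ-cong (allSubsets m) (λ s → *-congˡ (starBasisᵖ-false p s (false ∷ u))))
                (Σ-zero (allSubsets m) (λ s → trans (*-congˡ (starBasisᵖ-true₀ p s u)) (zeroʳ _))) ⟩
    starᵖ (not p) (f ₀) u + 0#                   ≈⟨ +-identityʳ _ ⟩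
    starᵖ (not p) (f ₀) u                        ∎

  starᵖ₁ : ∀ {m} p (f : G (suc m)) → starᵖ p f ₁ ≋ scal (sgn (not p)) (grade (starᵖ (not p) (f ₁)))
  starᵖ₁ {m} p f u = begin
    starᵖ p f (true ∷ u)                         ≈⟨ Σ-allSubsets-suc m _ ⟩
    Σ-list (allSubsets m) (λ s → f (false ∷ s) * starBasisᵖ p (false ∷ s) (true ∷ u))
      + Σ-list (allSubsets m) (λ s → f (true ∷ s) * starBasisᵖ p (true ∷ s) (true ∷ u))
      ≈⟨ +-cong (Σ-zero (allSubsets m) (λ s →
                  trans (*-congˡ (starBasisᵖ-false p s (true ∷ u))) (zeroʳ _)))
                (Σ-cong (allSubsets m) (λ s → *-congˡ (starBasisᵖ-true₁ p s u))) ⟩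
    0# + Σ-list (allSubsets m) (λ s → f (true ∷ s) * (sgn (not p) * grade (starBasisᵖ (not p) s) u))
      ≈⟨ +-identityˡ _ ⟩
    Σ-list (allSubsets m) (λ s → f (true ∷ s) * (sgn (not p) * grade (starBasisᵖ (not p) s) u))
      ≈⟨ grade-Σ (f ₁) (starBasisᵖ (not p)) _ u ⟩
    sgn (not p) * grade (starᵖ (not p) (f ₁)) u  ∎

  starᵖ-cong : ∀ {m} p {f g : G m} → f ≋ g → starᵖ p f ≋ starᵖ p g
  starᵖ-cong {m} p f≋g u = Σ-cong (allSubsets m) (λ s → *-congʳ (f≋g s))

  starᵖ-scal : ∀ {m} p r (f : G m) → starᵖ p (scal r f) ≋ scal r (starᵖ p f)
  starᵖ-scal {m} p r f u =
    trans (Σ-cong (allSubsets m) (λ s → *-assoc _ _ _)) (Σ-*ˡ (allSubsets m) r _)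

  gradeIf : ∀ {m} → Bool → G m → G m
  gradeIf false f = f
  gradeIf true  f = grade f

  gradeIf-cong : ∀ {m} e {f g : G m} → f ≋ g → gradeIf e f ≋ gradeIf e g
  gradeIf-cong false f≋g = f≋g
  gradeIf-cong true  f≋g = grade-cong f≋g

  gradeIf-scal : ∀ {m} e r (f : G m) → gradeIf e (scal r f) ≋ scal r (gradeIf e f)
  gradeIf-scal false r f u = refl
  gradeIf-scal true  r f u = grade-scal r f u

  grade-gradeIf : ∀ {m} e (f : G m) → grade (gradeIf e f) ≋ gradeIf (not e) f
  grade-gradeIf false f u = refl
  grade-gradeIf true  f u = grade-involutive f u

  gradeIf-grade : ∀ {m} e (f : G m) → gradeIf e (grade f) ≋ gradeIf (not e) f
  gradeIf-grade false f u = refl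
  gradeIf-grade true  f u = grade-involutive f u

  gradeIf₀ : ∀ {m} e (f : G (suc m)) → gradeIf e f ₀ ≋ gradeIf e (f ₀)
  gradeIf₀ false f u = refl
  gradeIf₀ true  f u = refl

  gradeIf₁ : ∀ {m} e (f : G (suc m)) → gradeIf e f ₁ ≋ scal (sgn e) (gradeIf e (f ₁))
  gradeIf₁ false f u = sym (*-identityˡ _)
  gradeIf₁ true  f u with odd (card u)
  ... | false = sym (-1*x≈-x _)
  ... | true  = sym (trans (-1*x≈-x _) (-‿involutive _))

  -- formᵖ false is form definitionally.
  formᵖ : ∀ {m} → Bool → G m → G m → Carrier
  formᵖ p f g = ∫ (gradeIf p (starᵖ p f) · g)

  formᵖ-cong : ∀ {m} p {f f′ g g′ : G m} → f ≋ f′ → g ≋ g′ → formᵖ p f g ≈ formᵖ p f′ g′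
  formᵖ-cong p f≋f′ g≋g′ = ·-cong (gradeIf-cong p (starᵖ-cong p f≋f′)) g≋g′ _

  formᵖ-scalˡ : ∀ {m} p r (f g : G m) → formᵖ p (scal r f) g ≈ r * formᵖ p f g
  formᵖ-scalˡ p r f g =
    trans (·-cong (λ u → trans (gradeIf-cong p (starᵖ-scal p r f) u) (gradeIf-scal p r _ u))
                  (λ _ → refl) _)
          (·-scalˡ r _ g _)

  formᵖ-scalʳ : ∀ {m} p r (f g : G m) → formᵖ p f (scal r g) ≈ r * formᵖ p f g
  formᵖ-scalʳ p r f g = ·-scalʳ r _ g _

  formᵖ-zero : ∀ p (f g : G 0) → formᵖ p f g ≈ f [] * g []
  formᵖ-zero false f g = trans (+-identityʳ _) (trans (+-identityʳ _)
    (trans (*-identityʳ _) (*-congʳ (trans (+-identityʳ _) (*-identityʳ _)))))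
  formᵖ-zero true  f g = trans (+-identityʳ _) (trans (+-identityʳ _)
    (trans (*-identityʳ _) (*-congʳ (trans (+-identityʳ _) (*-identityʳ _)))))

  formᵖ-suc : ∀ {m} p (f g : G (suc m)) →
              formᵖ p f g ≈ formᵖ (not p) (f ₀) (g ₁) - formᵖ (not p) (f ₁) (g ₀)
  formᵖ-suc {m} p f g = begin
    formᵖ p f g                                              ≈⟨ ·₁ F g _ ⟩
    ∫ (grade (F ₀) · g ₁) + ∫ (F ₁ · g ₀)
      ≈⟨ +-cong (·-cong F₀ (λ _ → refl) _) (·-cong F₁ (λ _ → refl) _) ⟩
    formᵖ (not p) (f ₀) (g ₁) + ∫ (scal (- 1#) F₁′ · g ₀)    ≈⟨ +-congˡ (·-scalˡ (- 1#) F₁′ (g ₀) _) ⟩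
    formᵖ (not p) (f ₀) (g ₁) + - 1# * formᵖ (not p) (f ₁) (g ₀)
                                                             ≈⟨ +-congˡ (-1*x≈-x _) ⟩
    formᵖ (not p) (f ₀) (g ₁) - formᵖ (not p) (f ₁) (g ₀)    ∎
    where
    F   = gradeIf p (starᵖ p f)
    F₁′ = gradeIf (not p) (starᵖ (not p) (f ₁))

    F₀ : grade (F ₀) ≋ gradeIf (not p) (starᵖ (not p) (f ₀))
    F₀ u = trans (grade-cong (λ s → trans (gradeIf₀ p _ s) (gradeIf-cong p (starᵖ₀ p f) s)) u)
                 (grade-gradeIf p _ u)

    F₁ : F ₁ ≋ scal (- 1#) F₁′
    F₁ u = begin
      F (true ∷ u)                                 ≈⟨ gradeIf₁ p _ u ⟩
      sgn p * gradeIf p (starᵖ p f ₁) u            ≈⟨ *-congˡ (gradeIf-cong p (starᵖ₁ p f) u) ⟩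
      sgn p * gradeIf p (scal (sgn (not p)) (grade (starᵖ (not p) (f ₁)))) u
                                                   ≈⟨ *-congˡ (gradeIf-scal p _ _ u) ⟩
      sgn p * (sgn (not p) * gradeIf p (grade (starᵖ (not p) (f ₁))) u)
                                                   ≈⟨ *-congˡ (*-congˡ (gradeIf-grade p _ u)) ⟩
      sgn p * (sgn (not p) * F₁′ u)                ≈⟨ *-assoc _ _ _ ⟨
      sgn p * sgn (not p) * F₁′ u                  ≈⟨ *-congʳ (sgn-not p) ⟩
      - 1# * F₁′ u                                 ∎

  formᵖ-K-suc : ∀ {m} p (X Y : Fin (suc m) → Carrier) →
                formᵖ p (K X) (K Y) ≈ (Y Fin.zero - X Fin.zero) * formᵖ (not p) (K (tail X)) (K (tail Y))
  formᵖ-K-suc {m} p X Y = begin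
    formᵖ p (K X) (K Y)                                              ≈⟨ formᵖ-suc p (K X) (K Y) ⟩
    formᵖ (not p) (K X ₀) (K Y ₁) - formᵖ (not p) (K X ₁) (K Y ₀)
      ≈⟨ +-cong (trans (formᵖ-cong {m} (not p) (K₀ X) (K₁ Y))
                       (formᵖ-scalʳ (not p) (Y Fin.zero) K′X K′Y))
                (-‿cong (trans (formᵖ-cong {m} (not p) (K₁ X) (K₀ Y))
                               (formᵖ-scalˡ (not p) (X Fin.zero) K′X K′Y))) ⟩
    Y Fin.zero * φ - X Fin.zero * φ                                  ≈⟨ +-congˡ (-‿distribˡ-* _ _) ⟩
    Y Fin.zero * φ + - X Fin.zero * φ                                ≈⟨ distribʳ _ _ _ ⟨
    (Y Fin.zero - X Fin.zero) * φ                                    ∎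
    where
    K′X = K (tail X)
    K′Y = K (tail Y)
    φ   = formᵖ (not p) K′X K′Y

  formᵖ-K : ∀ {m} p (X Y : Fin m → Carrier) → formᵖ p (K X) (K Y) ≈ ∏-list (allFin m) (λ i → Y i - X i)
  formᵖ-K {zero}  p X Y = trans (formᵖ-zero p (K X) (K Y)) (*-identityˡ 1#)
  formᵖ-K {suc m} p X Y = begin
    formᵖ p (K X) (K Y)                                  ≈⟨ formᵖ-K-suc p X Y ⟩
    (Y Fin.zero - X Fin.zero) * formᵖ (not p) (K (tail X)) (K (tail Y))
                                                         ≈⟨ *-congˡ (formᵖ-K (not p) (tail X) (tail Y)) ⟩
    (Y Fin.zero - X Fin.zero) * ∏-list (allFin m) (λ i → Y (Fin.suc i) - X (Fin.suc i))
                                                         ≈⟨ ∏-allFin-suc (λ i → Y i - X i) ⟨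
    ∏-list (allFin (suc m)) (λ i → Y i - X i)            ∎

mainTheorem10 : ∀ {c ℓ} (R : CommutativeRing c ℓ) (n : ℕ) → 1 ≤ n →
    (X Y : Fin (n ∸ 1) → CommutativeRing.Carrier R) →
    CommutativeRing._≈_ R
      (Grassmann.form R (Grassmann.K R X) (Grassmann.K R Y))
      (Grassmann.∏-list R (allFin (n ∸ 1))
        (λ i → CommutativeRing._-_ R (Y i) (X i)))
mainTheorem10 R n _ X Y = formᵖ-K R false X Y
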